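{- Let $F$ be a finite poset with $|F|>1$ such that (i) $F$ has at least two minimal elements, and (ii) every maximal element of $F$ has a lower cover (in $F$) which is not a minimal element of $F$. Then $\chi_{ac}(F)=2$.
   Context: All posets are finite. A poset $P$ is $F$-free if $P$ contains no subposet isomorphic to $F$. A subset $S$ of a poset $P$ (with the induced order) is maximal $F$-free if $S$ is $F$-free but every subset of $P$ strictly containing $S$ contains a subposet isomorphic to $F$. For a finite poset $F$ with $|F|>1$, $\chi_{ac}(F)$ is the smallest integer $n$ (if it exists) such that for every finite poset $P$ with $|P|>1$, the elements of $P$ can be coloured with at most $n$ colours so that every maximal $F$-free subset of $P$ with more than one element receives at least two colours. A lower cover of an element $x$ is an element $y<x$ such that there is no $z$ with $y<z<x$. -}

module Defs where

open import Data.Nat using (ℕ; _<_; _≤_)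
open import Data.Fin using (Fin)
open import Data.Fin.Subset using (Subset; _∈_; _⊂_; ∣_∣)
open import Data.Product using (Σ; ∃; ∃-syntax; _×_; _,_)
open import Relation.Nullary using (¬_; Dec)
open import Relation.Binary.PropositionalEquality using (_≡_; _≢_)
open import Relation.Binary.Structures using (IsPartialOrder)
open import Function.Bundles using (_⇔_)
open import Function.Definitions using (Injective)

record FinPoset : Set₁ where
  field
    size  : ℕ
    _≤ₚ_  : Fin size → Fin size → Set
    isPO  : IsPartialOrder _≡_ _≤ₚ_
    dec   : ∀ x y → Dec (x ≤ₚ y)

open FinPoset public

module _ (P : FinPoset) where
  private
    X = Fin (size P)
    _≤'_ = _≤ₚ_ P

  _<ₚ_ : X → X → Set
  x <ₚ y = x ≤' y × x ≢ y

  Minimal : X → Set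
  Minimal x = ∀ y → y ≤' x → y ≡ x

  Maximal : X → Set
  Maximal x = ∀ y → x ≤' y → y ≡ x

  LowerCover : X → X → Set
  LowerCover y x = y <ₚ x × ¬ (∃[ z ] (y <ₚ z × z <ₚ x))

-- S ⊆ P contains a subposet (with the induced order) isomorphic to F:
-- an injective map F → S that is an order embedding.
ContainsCopy : (F P : FinPoset) → Subset (size P) → Set
ContainsCopy F P S =
  Σ (Fin (size F) → Fin (size P)) λ f →
    Injective _≡_ _≡_ f
    × (∀ i → f i ∈ S)
    × (∀ i j → (_≤ₚ_ F i j ⇔ _≤ₚ_ P (f i) (f j)))

FFree : (F P : FinPoset) → Subset (size P) → Set
FFree F P S = ¬ ContainsCopy F P S

MaximalFFree : (F P : FinPoset) → Subset (size P) → Set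
MaximalFFree F P S = FFree F P S × (∀ T → S ⊂ T → ContainsCopy F P T)

ACColourable : FinPoset → ℕ → Set₁
ACColourable F n =
  ∀ (P : FinPoset) → 1 < size P →
    Σ (Fin (size P) → Fin n) λ c →
      ∀ S → MaximalFFree F P S → 1 < ∣ S ∣ →
        ∃[ x ] ∃[ y ] (x ∈ S × y ∈ S × c x ≢ c y)

χac≡ : FinPoset → ℕ → Set₁
χac≡ F k = ACColourable F k × (∀ n → ACColourable F n → k ≤ n)

-- Two colours are needed because a two-element antichain is F-free
-- (condition (ii) forces F to have a strict comparison), so it is itself
-- a maximal F-free set. Two colours suffice: an antichain P is F-free,
-- so its only maximal F-free subset is P itself. Otherwise choose a
-- non-minimal c all of whose strict lower elements are minimal, and some
-- p < c, and colour x by whether p < x. A maximal F-free S cannot lie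
-- strictly above p: a copy of F in S ∪ {p} must pass through p, which
-- would then be a least element of F, against (i). Nor can S miss the
-- up-set of c: a copy of F in S ∪ {c} through c sends a maximal element
-- m of F to c, and the non-minimal y < m given by (ii) strictly below c,
-- where every element is minimal in P; so the copy identifies y with any
-- z < y.
module Submission where

open import Defs
open import Data.Nat using (ℕ; zero; suc; _<_; _≤_; z≤n; s≤s)
open import Data.Fin using (Fin; zero; suc; _≟_)
open import Data.Fin.Properties using (any?)
open import Data.Fin.Induction using (po-wellFounded)
open import Data.Fin.Subset using (Subset; _∈_; _∉_; _⊂_; _⊆_; ∣_∣; _∪_; ⁅_⁆; ⊤)
open import Data.Fin.Subset.Properties
  using (_∈?_; ∈⊤; ⊆⊤; x∈⁅x⁆; x∈⁅y⁆⇒x≡y; p⊆p∪q; x∈p∪q⁻; x∈p∪q⁺)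
open import Data.Product using (Σ; Σ-syntax; ∃-syntax; _×_; _,_; proj₁; proj₂)
open import Data.Sum using (_⊎_; inj₁; inj₂)
open import Function.Base using (_∘_)
open import Function.Bundles using (_⇔_; Equivalence)
open import Function.Definitions using (Injective)
open import Induction.WellFounded using (WellFounded; Acc; acc)
open import Relation.Nullary using (¬_; Dec; yes; no)
open import Relation.Nullary.Decidable using (_×-dec_; ¬?; decidable-stable)
open import Relation.Nullary.Negation using (contradiction)
open import Relation.Unary using (Decidable)
open import Relation.Binary.Structures using (IsPartialOrder)
open import Relation.Binary.PropositionalEquality using (_≡_; _≢_; refl; sym; trans; subst)
open import Relation.Binary.PropositionalEquality.Properties using (isPartialOrder)

open Equivalence using (to; from)

Antichain : FinPoset → Set
Antichain P = ∀ x y → _≤ₚ_ P x y → x ≡ y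

module FinPosetProperties (P : FinPoset) where
  private
    _≼_ = _≤ₚ_ P
    _≺_ = _<ₚ_ P

  open IsPartialOrder (isPO P) public using () renaming (refl to ≼-refl; trans to ≼-trans; antisym to ≼-antisym)

  _≺?_ : ∀ x y → Dec (x ≺ y)
  x ≺? y = dec P x y ×-dec ¬? (x ≟ y)

  ≺-≼-trans : ∀ {x y z} → x ≺ y → y ≼ z → x ≺ z
  ≺-≼-trans (x≼y , x≢y) y≼z =
    ≼-trans x≼y y≼z , λ x≡z → x≢y (≼-antisym x≼y (subst (_ ≼_) (sym x≡z) y≼z))

  ≺-wellFounded : WellFounded _≺_
  ≺-wellFounded = po-wellFounded (isPO P)

  nothing-below⇒minimal : ∀ {x} → ¬ (∃[ w ] w ≺ x) → Minimal P x
  nothing-below⇒minimal {x} nothing-below y y≼x =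
    decidable-stable (y ≟ x) λ y≢x → nothing-below (y , y≼x , y≢x)

  ¬minimal⇒∃≺ : ∀ {x} → ¬ Minimal P x → ∃[ w ] w ≺ x
  ¬minimal⇒∃≺ {x} ¬min = decidable-stable (any? (_≺? x)) (¬min ∘ nothing-below⇒minimal)

  minimal? : Decidable (Minimal P)
  minimal? x with any? (_≺? x)
  ... | yes (w , w≼x , w≢x) = no λ min → w≢x (min w w≼x)
  ... | no nothing-below = yes (nothing-below⇒minimal nothing-below)

  antichain⊎∃≺ : Antichain P ⊎ ∃[ x ] ∃[ y ] x ≺ y
  antichain⊎∃≺ with any? (λ x → any? (x ≺?_))
  ... | yes x≺y = inj₂ x≺y
  ... | no none = inj₁ λ x y x≼y → decidable-stable (x ≟ y) λ x≢y → none (x , y , x≼y , x≢y)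

  lowest-nonminimal : ∀ {x} → Acc _≺_ x → ¬ Minimal P x →
    ∃[ c ] (¬ Minimal P c × ∀ w → w ≺ c → Minimal P w)
  lowest-nonminimal {x} (acc below) ¬min with any? (λ w → w ≺? x ×-dec ¬? (minimal? w))
  ... | yes (w , w≺x , ¬min-w) = lowest-nonminimal (below w≺x) ¬min-w
  ... | no none = x , ¬min , λ w w≺x → decidable-stable (minimal? w) λ ¬min-w → none (w , w≺x , ¬min-w)

  ∃-height-one : ∀ {x y} → x ≺ y → ∃[ p ] ∃[ c ] (p ≺ c × ∀ w → w ≺ c → Minimal P w)
  ∃-height-one {x} {y} (x≼y , x≢y) with lowest-nonminimal (≺-wellFounded y) (λ min → x≢y (min x x≼y))
  ... | c , ¬min-c , below-c-minimal with ¬minimal⇒∃≺ ¬min-c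
  ...   | p , p≺c = p , c , p≺c , below-c-minimal

IsOrderEmbedding : (F P : FinPoset) → (Fin (size F) → Fin (size P)) → Set
IsOrderEmbedding F P g = ∀ i j → (_≤ₚ_ F i j ⇔ _≤ₚ_ P (g i) (g j))

NoLeast : FinPoset → Set
NoLeast F = ∀ k → ¬ (∀ i → _≤ₚ_ F k i)

MaximalsAboveNonminimal : FinPoset → Set
MaximalsAboveNonminimal F = ∀ m → Maximal F m → ∃[ y ] (_<ₚ_ F y m × ¬ Minimal F y)

module _ {n : ℕ} where

  ⊂-∪⁅⁆ : ∀ {S : Subset n} {x} → x ∉ S → S ⊂ S ∪ ⁅ x ⁆
  ⊂-∪⁅⁆ {x = x} x∉S = p⊆p∪q ⁅ x ⁆ , x , x∈p∪q⁺ (inj₂ (x∈⁅x⁆ x)) , x∉S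

  ∈-∪⁅⁆⁻ : ∀ {S : Subset n} {x y} → y ∈ S ∪ ⁅ x ⁆ → y ∈ S ⊎ y ≡ x
  ∈-∪⁅⁆⁻ {S} {x} y∈ with x∈p∪q⁻ S ⁅ x ⁆ y∈
  ... | inj₁ y∈S = inj₁ y∈S
  ... | inj₂ y∈⁅x⁆ = inj₂ (x∈⁅y⁆⇒x≡y x y∈⁅x⁆)

module Copies (F P : FinPoset) where
  private
    _≼_ = _≤ₚ_ P
    _≺_ = _<ₚ_ P
  open FinPosetProperties P

  embedding-preserves-≺ : ∀ {g} → Injective _≡_ _≡_ g → IsOrderEmbedding F P g →
    ∀ {i j} → _<ₚ_ F i j → g i ≺ g j
  embedding-preserves-≺ inj emb {i} {j} (i≤j , i≢j) = to (emb i j) i≤j , i≢j ∘ inj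

  embedding-reflects-minimal : ∀ {g} → Injective _≡_ _≡_ g → IsOrderEmbedding F P g →
    ∀ {i} → Minimal P (g i) → Minimal F i
  embedding-reflects-minimal {g} inj emb {i} min j j≤i = inj (min (g j) (to (emb j i) j≤i))

  copy-mono : ∀ {S T} → S ⊆ T → ContainsCopy F P S → ContainsCopy F P T
  copy-mono S⊆T (g , inj , g∈S , emb) = g , inj , (λ i → S⊆T (g∈S i)) , emb

  copy-reflects-antichain : ∀ {S} → Antichain P → ContainsCopy F P S → Antichain F
  copy-reflects-antichain antichain (g , inj , _ , emb) i j i≤j = inj (antichain _ _ (to (emb i j) i≤j))

  maximalFFree-extend : ∀ {S x} → MaximalFFree F P S → x ∉ S →
    Σ (ContainsCopy F P (S ∪ ⁅ x ⁆)) λ copy → ∃[ k ] proj₁ copy k ≡ x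
  maximalFFree-extend {S} {x} (free , maximal) x∉S with maximal (S ∪ ⁅ x ⁆) (⊂-∪⁅⁆ x∉S)
  ... | copy@(g , inj , g∈ , emb) =
    copy , decidable-stable (any? (λ k → g k ≟ x)) λ avoids-x → free (g , inj , g∈S avoids-x , emb)
    where
    g∈S : ¬ (∃[ k ] g k ≡ x) → ∀ i → g i ∈ S
    g∈S avoids-x i with ∈-∪⁅⁆⁻ (g∈ i)
    ... | inj₁ gi∈S = gi∈S
    ... | inj₂ gi≡x = contradiction (i , gi≡x) avoids-x

  FFree-⊤⇒maximalFFree-⊤ : FFree F P ⊤ → MaximalFFree F P ⊤
  FFree-⊤⇒maximalFFree-⊤ free = free , λ { T (_ , x , _ , x∉⊤) → contradiction ∈⊤ x∉⊤ }

  FFree-⊤⇒maximalFFree-full : ∀ {S} → FFree F P ⊤ → MaximalFFree F P S → ∀ x → x ∈ S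
  FFree-⊤⇒maximalFFree-full {S} free maxS x =
    decidable-stable (x ∈? S) λ x∉S → free (copy-mono ⊆⊤ (proj₁ (maximalFFree-extend maxS x∉S)))

  maximalFFree-¬strictly-above : ∀ {S} → NoLeast F → MaximalFFree F P S →
    ∀ p → ∃[ t ] (t ∈ S × ¬ p ≺ t)
  maximalFFree-¬strictly-above {S} no-least maxS p =
    decidable-stable (any? (λ t → t ∈? S ×-dec ¬? (p ≺? t))) λ none →
      ¬all-above λ t t∈S → decidable-stable (p ≺? t) λ ¬p≺t → none (t , t∈S , ¬p≺t)
    where
    ¬all-above : ¬ (∀ t → t ∈ S → p ≺ t)
    ¬all-above all-above with maximalFFree-extend maxS (λ p∈S → proj₂ (all-above p p∈S) refl)
    ... | (g , _ , g∈ , emb) , k , gk≡p = no-least k λ i → from (emb k i) (subst (_≼ g i) (sym gk≡p) (p≼g i))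
      where
      p≼g : ∀ i → p ≼ g i
      p≼g i with ∈-∪⁅⁆⁻ (g∈ i)
      ... | inj₁ gi∈S = proj₁ (all-above (g i) gi∈S)
      ... | inj₂ gi≡p = subst (p ≼_) (sym gi≡p) ≼-refl

  copy-through-top⇒maximal : ∀ {S c g j} → ¬ (∃[ t ] (t ∈ S × c ≼ t)) →
    Injective _≡_ _≡_ g → IsOrderEmbedding F P g → (∀ i → g i ∈ S ∪ ⁅ c ⁆) → g j ≡ c → Maximal F j
  copy-through-top⇒maximal {g = g} {j} nothing-above inj emb g∈ gj≡c i j≤i with ∈-∪⁅⁆⁻ (g∈ i)
  ... | inj₁ gi∈S = contradiction (g i , gi∈S , subst (_≼ g i) gj≡c (to (emb j i) j≤i)) nothing-above
  ... | inj₂ gi≡c = inj (trans gi≡c (sym gj≡c))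

  maximalFFree-meets-↑ : ∀ {S} → MaximalsAboveNonminimal F → MaximalFFree F P S →
    ∀ c → (∀ w → w ≺ c → Minimal P w) → ∃[ t ] (t ∈ S × c ≼ t)
  maximalFFree-meets-↑ {S} maximals-above maxS c below-c-minimal with c ∈? S
  ... | yes c∈S = c , c∈S , ≼-refl
  ... | no c∉S = decidable-stable (any? (λ t → t ∈? S ×-dec dec P c t)) ¬nothing-above
    where
    ¬nothing-above : ¬ ¬ (∃[ t ] (t ∈ S × c ≼ t))
    ¬nothing-above nothing-above with maximalFFree-extend maxS c∉S
    ... | (g , inj , g∈ , emb) , j , gj≡c
      with maximals-above j (copy-through-top⇒maximal nothing-above inj emb g∈ gj≡c)
    ...   | y , y≺j , ¬min-y = ¬min-y (embedding-reflects-minimal inj emb (below-c-minimal (g y) gy≺c))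
      where
      gy≺c : g y ≺ c
      gy≺c = subst (g y ≺_) gj≡c (embedding-preserves-≺ inj emb y≺j)

  antichain-FFree : ¬ Antichain F → Antichain P → ∀ S → FFree F P S
  antichain-FFree ¬antichain-F antichain-P S copy = ¬antichain-F (copy-reflects-antichain antichain-P copy)

distinct-minimals⇒NoLeast : ∀ F {a b} → a ≢ b → Minimal F a → Minimal F b → NoLeast F
distinct-minimals⇒NoLeast F a≢b min-a min-b k k-least =
  a≢b (trans (sym (min-a k (k-least _))) (min-b k (k-least _)))

MaximalsAboveNonminimal⇒¬Antichain : ∀ F → MaximalsAboveNonminimal F → Fin (size F) → ¬ Antichain F
MaximalsAboveNonminimal⇒¬Antichain F maximals-above a antichain
  with maximals-above a (λ y a≤y → sym (antichain a y a≤y))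
... | y , (y≤a , y≢a) , _ = y≢a (antichain y a y≤a)

∃-distinct : ∀ {n} → 1 < n → Σ[ x ∈ Fin n ] Σ[ y ∈ Fin n ] x ≢ y
∃-distinct (s≤s (s≤s z≤n)) = zero , suc zero , λ ()

distinct⇒2≤ : ∀ {n} {x y : Fin n} → x ≢ y → 2 ≤ n
distinct⇒2≤ {suc zero} {zero} {zero} x≢y = contradiction refl x≢y
distinct⇒2≤ {suc (suc _)} _ = s≤s (s≤s z≤n)

indicator : ∀ {A : Set} → Dec A → Fin 2
indicator (yes _) = suc zero
indicator (no _) = zero

indicator-separates : ∀ {A B : Set} (a? : Dec A) (b? : Dec B) → A → ¬ B → indicator a? ≢ indicator b?
indicator-separates (yes _) (no _) _ _ ()
indicator-separates (yes _) (yes b) _ ¬b = contradiction b ¬b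
indicator-separates (no ¬a) _ a _ = contradiction a ¬a

IsACColouring : (F P : FinPoset) {n : ℕ} → (Fin (size P) → Fin n) → Set
IsACColouring F P c =
  ∀ S → MaximalFFree F P S → 1 < ∣ S ∣ → ∃[ x ] ∃[ y ] (x ∈ S × y ∈ S × c x ≢ c y)

module Colourings (F P : FinPoset) where
  open FinPosetProperties P
  open Copies F P

  antichain-colouring : ¬ Antichain F → Antichain P → 1 < size P →
    Σ[ c ∈ (Fin (size P) → Fin 2) ] IsACColouring F P c
  antichain-colouring ¬antichain-F antichain-P 1<|P| with ∃-distinct 1<|P|
  ... | x₀ , x₁ , x₀≢x₁ = (λ x → indicator (x ≟ x₀)) , λ S maxS _ →
    x₀ , x₁ , full maxS x₀ , full maxS x₁ , indicator-separates (x₀ ≟ x₀) (x₁ ≟ x₀) refl (x₀≢x₁ ∘ sym)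
    where
    full : ∀ {S} → MaximalFFree F P S → ∀ x → x ∈ S
    full = FFree-⊤⇒maximalFFree-full (antichain-FFree ¬antichain-F antichain-P ⊤)

  height-one-colouring : NoLeast F → MaximalsAboveNonminimal F →
    ∀ {p c} → _<ₚ_ P p c → (∀ w → _<ₚ_ P w c → Minimal P w) → IsACColouring F P (λ x → indicator (p ≺? x))
  height-one-colouring no-least maximals-above {p} {c} p≺c below-c-minimal S maxS _
    with maximalFFree-meets-↑ maximals-above maxS c below-c-minimal
       | maximalFFree-¬strictly-above no-least maxS p
  ... | t , t∈S , c≼t | u , u∈S , ¬p≺u =
    t , u , t∈S , u∈S , indicator-separates (p ≺? t) (p ≺? u) (≺-≼-trans p≺c c≼t) ¬p≺u

antichain₂ : FinPoset
antichain₂ = record { size = 2 ; _≤ₚ_ = _≡_ ; isPO = isPartialOrder ; dec = _≟_ }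

antichain₂-maximalFFree : ∀ F → ¬ Antichain F → MaximalFFree F antichain₂ ⊤
antichain₂-maximalFFree F ¬antichain-F =
  FFree-⊤⇒maximalFFree-⊤ (antichain-FFree ¬antichain-F (λ _ _ x≡y → x≡y) ⊤)
  where open Copies F antichain₂

module _ (F : FinPoset) where

  χac≤2 : ¬ Antichain F → NoLeast F → MaximalsAboveNonminimal F → ACColourable F 2
  χac≤2 ¬antichain-F no-least maximals-above P 1<|P| with FinPosetProperties.antichain⊎∃≺ P
  ... | inj₁ antichain-P =
    Colourings.antichain-colouring F P ¬antichain-F antichain-P 1<|P|
  ... | inj₂ (_ , _ , x≺y) with FinPosetProperties.∃-height-one P x≺y
  ...   | p , c , p≺c , below-c-minimal =
    _ , Colourings.height-one-colouring F P no-least maximals-above p≺c below-c-minimal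

  2≤χac : ¬ Antichain F → ∀ n → ACColourable F n → 2 ≤ n
  2≤χac ¬antichain-F _ colourable with colourable antichain₂ (s≤s (s≤s z≤n))
  ... | _ , separates with separates ⊤ (antichain₂-maximalFFree F ¬antichain-F) (s≤s (s≤s z≤n))
  ... | _ , _ , _ , _ , cx≢cy = distinct⇒2≤ cx≢cy

theorem3 : (F : FinPoset) → 1 < size F
    → (∃[ a ] ∃[ b ] (a ≢ b × Minimal F a × Minimal F b))
    → (∀ m → Maximal F m → ∃[ y ] (LowerCover F y m × ¬ Minimal F y))
    → χac≡ F 2
theorem3 F _ (a , b , a≢b , min-a , min-b) maximals-lower-cover =
  χac≤2 F ¬antichain-F no-least maximals-above , 2≤χac F ¬antichain-F
  where
  no-least : NoLeast F
  no-least = distinct-minimals⇒NoLeast F a≢b min-a min-b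
  maximals-above : MaximalsAboveNonminimal F
  maximals-above m max-m with maximals-lower-cover m max-m
  ... | y , (y<m , _) , ¬min-y = y , y<m , ¬min-y
  ¬antichain-F : ¬ Antichain F
  ¬antichain-F = MaximalsAboveNonminimal⇒¬Antichain F maximals-above a
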